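{- Let $c_1,\dots,c_m\in\mathbb N$, $\sigma_m=c_1+\dots+c_m$, $a=1+\sigma_m$, and $s\in\mathbb N$. Then $\frac{|\Delta_{c_1\dots c_ms}|}{|\Delta_{c_1\dots c_m}|}=\frac{a}{(a+s-1)(a+s)}=:f_s(a)$. Moreover $f_s(a)\le\frac1{2(2s-1)}$, and if $m\ge s-1$ then $\frac{|\Delta_{c_1\dots c_ms}|}{|\Delta_{c_1\dots c_m}|}\le\frac{m+1}{(m+s)(m+s+1)}$.
   Context: Every irrational $x\in(0,1)$ has a unique expansion $x=\sum_{n\ge1}\frac{(-1)^{n-1}}{g_1(g_1+g_2)\cdots(g_1+\dots+g_n)}$ with all $g_n\in\mathbb N$; $g_n(x)$ is the $n$-th $\bar O^1$-symbol of $x$. For $c_1,\dots,c_m\in\mathbb N$ the cylinder $\Delta_{c_1\dots c_m}$ is the closure of the set of $x\in(0,1)$ whose first $m$ symbols are $c_1,\dots,c_m$; it is a closed interval with endpoints $\sum_{n=1}^m\frac{(-1)^{n-1}}{\sigma_1\cdots\sigma_n}$ and the same sum with $c_m$ replaced by $c_m+1$, where $\sigma_k=c_1+\dots+c_k$, and its length is $|\Delta_{c_1\dots c_m}|=\frac1{\sigma_1\sigma_2\cdots\sigma_m(\sigma_m+1)}$. -}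

module Defs where

open import Data.Nat as ℕ using (ℕ; zero; suc; _+_; _*_)
open import Data.Vec using (Vec; []; _∷_; sum)
open import Data.Rational using (ℚ; 0ℚ; _÷_; ≢-nonZero; _/_)
open import Data.Integer using (+_)
open import Data.Rational.Properties using (_≟_)
open import Relation.Nullary using (yes; no)

fromℕ : ℕ → ℚ
fromℕ n = (+ n) / 1

-- total division on ℚ (x ÷ᵗ 0 = 0); only ever applied to nonzero divisors
-- under the hypotheses of the statement
_÷ᵗ_ : ℚ → ℚ → ℚ
p ÷ᵗ q with q ≟ 0ℚ
... | yes _ = 0ℚ
... | no q≢0 = _÷_ p q {{≢-nonZero q≢0}}

partialSums : ∀ {m} → Vec ℕ m → Vec ℕ m
partialSums []       = []
partialSums (c ∷ cs) = c ∷ go c cs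
  where
  go : ∀ {k} → ℕ → Vec ℕ k → Vec ℕ k
  go acc []       = []
  go acc (d ∷ ds) = (acc + d) ∷ go (acc + d) ds

prod : ∀ {m} → Vec ℕ m → ℕ
prod []       = 1
prod (x ∷ xs) = x * prod xs

cylLength : ∀ {m} → Vec ℕ m → ℚ
cylLength c = fromℕ 1 ÷ᵗ fromℕ (prod (partialSums c) * suc (sum c))

f : ℕ → ℕ → ℚ
f s a = fromℕ a ÷ᵗ fromℕ ((a + s ℕ.∸ 1) * (a + s))

{-# OPTIONS --safe #-}
-- Appending s to c₁ … cₘ appends the partial sum σ + s (σ = c₁ + ⋯ + cₘ), so the cylinder
-- shrinks by the factor (σ + 1)/((σ + s)(σ + s + 1)) = f_s(σ + 1). The bound on f_s holds because
-- (a + s − 1)(a + s) − 2a(2s − 1) = (a − s)(a − s + 1) is a product of consecutive integers.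
-- Finally f_s(a + 1) ≤ f_s(a) exactly when a ≥ s − 1, and σ ≥ m since every cᵢ ≥ 1, so
-- f_s(σ + 1) ≤ f_s(m + 1).
module Submission where

open import Defs
open import Data.Integer as ℤ using (+_; +[1+_])
import Data.Integer.Properties as ℤ
import Data.List as List
open import Data.Nat using (ℕ; suc; _+_; _*_; _∸_; _≤_; _<_; z≤n; NonZero; >-nonZero; ≢-nonZero)
open import Data.Nat.Coprimality using (Coprime; 1-coprimeTo) renaming (sym to coprime-sym)
open import Data.Nat.Properties
  using (+-assoc; +-comm; +-identityʳ; +-suc; +-mono-≤; *-assoc; *-comm; *-identityˡ; *-identityʳ;
         m+1+n≢0; m*n≢0; m≤m+n; ≤-<-connex; m≤n⇒∃[o]m+o≡n; module ≤-Reasoning)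
open import Data.Nat.Tactic.RingSolver using (solve)
open import Data.Product using (_×_; _,_)
open import Data.Rational using (mkℚ; toℚᵘ) renaming (_≤_ to _≤ℚ_)
import Data.Rational.Properties as ℚ
open import Data.Rational.Unnormalised using (*≡*; *≤*; _≃_; _/_) renaming (_*_ to _*ᵘ_; _≤_ to _≤ᵘ_)
import Data.Rational.Unnormalised.Properties as ℚᵘ
open import Data.Sum using (inj₁; inj₂)
open import Data.Vec using (Vec; []; _∷_; _∷ʳ_; sum)
open import Data.Vec.Relation.Unary.All using (All; []; _∷_)
open import Relation.Binary.PropositionalEquality
  using (_≡_; refl; sym; trans; cong; cong₂; subst₂; module ≡-Reasoning)

fromℕ≡mkℚ : ∀ n → fromℕ n ≡ mkℚ (+ n) 0 (coprime-sym (1-coprimeTo n))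
fromℕ≡mkℚ n = ℚ.normalize-coprime _

-- The test q ≟ 0ℚ inside p ÷ᵗ q only reduces once q is a mkℚ with a visibly positive numerator.
toℚᵘ-÷ᵗ-positive : ∀ p {n d} .(c : Coprime (suc n) (suc d)) →
                   toℚᵘ (p ÷ᵗ mkℚ +[1+ n ] d c) ≃ toℚᵘ p *ᵘ (+[1+ d ] / suc n)
toℚᵘ-÷ᵗ-positive p c = ℚ.toℚᵘ-homo-* p _

toℚᵘ-fromℕ-÷ᵗ-fromℕ : ∀ a b .{{_ : NonZero b}} → toℚᵘ (fromℕ a ÷ᵗ fromℕ b) ≃ + a / b
toℚᵘ-fromℕ-÷ᵗ-fromℕ a (suc b) rewrite fromℕ≡mkℚ a | fromℕ≡mkℚ (suc b) =
  ℚᵘ.≃-trans (toℚᵘ-÷ᵗ-positive (mkℚ (+ a) 0 (coprime-sym (1-coprimeTo a)))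
                               (coprime-sym (1-coprimeTo (suc b))))
             (*≡* (ℤ.*-assoc (+ a) (+ 1) (+ suc b)))

+/-≃-cross : ∀ {a b c d} .{{_ : NonZero b}} .{{_ : NonZero d}} → a * d ≡ c * b → + a / b ≃ + c / d
+/-≃-cross {a} {suc b} {c} {suc d} eq =
  *≡* (subst₂ _≡_ (ℤ.pos-* a (suc d)) (ℤ.pos-* c (suc b)) (cong +_ eq))

+/-≤-cross : ∀ {a b c d} .{{_ : NonZero b}} .{{_ : NonZero d}} → a * d ≤ c * b → + a / b ≤ᵘ + c / d
+/-≤-cross {a} {suc b} {c} {suc d} le =
  *≤* (subst₂ ℤ._≤_ (ℤ.pos-* a (suc d)) (ℤ.pos-* c (suc b)) (ℤ.+≤+ le))

fromℕ-÷ᵗ-fromℕ-≡ : ∀ a b c d .{{_ : NonZero b}} .{{_ : NonZero d}} →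
                   a * d ≡ c * b → fromℕ a ÷ᵗ fromℕ b ≡ fromℕ c ÷ᵗ fromℕ d
fromℕ-÷ᵗ-fromℕ-≡ a b c d eq = ℚ.toℚᵘ-injective (begin
  toℚᵘ (fromℕ a ÷ᵗ fromℕ b)  ≈⟨ toℚᵘ-fromℕ-÷ᵗ-fromℕ a b ⟩
  + a / b                    ≈⟨ +/-≃-cross eq ⟩
  + c / d                    ≈⟨ toℚᵘ-fromℕ-÷ᵗ-fromℕ c d ⟨
  toℚᵘ (fromℕ c ÷ᵗ fromℕ d)  ∎)
  where open ℚᵘ.≃-Reasoning

fromℕ-÷ᵗ-fromℕ-≤ : ∀ a b c d .{{_ : NonZero b}} .{{_ : NonZero d}} →
                   a * d ≤ c * b → fromℕ a ÷ᵗ fromℕ b ≤ℚ fromℕ c ÷ᵗ fromℕ d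
fromℕ-÷ᵗ-fromℕ-≤ a b c d le = ℚ.toℚᵘ-cancel-≤
  (ℚᵘ.≤-respˡ-≃ (ℚᵘ.≃-sym (toℚᵘ-fromℕ-÷ᵗ-fromℕ a b))
    (ℚᵘ.≤-respʳ-≃ (ℚᵘ.≃-sym (toℚᵘ-fromℕ-÷ᵗ-fromℕ c d)) (+/-≤-cross le)))

1÷ᵗ-÷ᵗ-1÷ᵗ : ∀ x y .{{_ : NonZero x}} .{{_ : NonZero y}} →
             (fromℕ 1 ÷ᵗ fromℕ y) ÷ᵗ (fromℕ 1 ÷ᵗ fromℕ x) ≡ fromℕ x ÷ᵗ fromℕ y
1÷ᵗ-÷ᵗ-1÷ᵗ x@(suc x-1) y@(suc _) = ℚ.toℚᵘ-injective (begin
  toℚᵘ ((fromℕ 1 ÷ᵗ fromℕ y) ÷ᵗ (fromℕ 1 ÷ᵗ fromℕ x))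
    ≡⟨ cong (λ q → toℚᵘ ((fromℕ 1 ÷ᵗ fromℕ y) ÷ᵗ q)) 1÷ᵗx≡mkℚ ⟩
  toℚᵘ ((fromℕ 1 ÷ᵗ fromℕ y) ÷ᵗ mkℚ (+ 1) x-1 (1-coprimeTo x))
    ≈⟨ toℚᵘ-÷ᵗ-positive (fromℕ 1 ÷ᵗ fromℕ y) (1-coprimeTo x) ⟩
  toℚᵘ (fromℕ 1 ÷ᵗ fromℕ y) *ᵘ (+ x / 1)
    ≈⟨ ℚᵘ.*-congʳ (toℚᵘ-fromℕ-÷ᵗ-fromℕ 1 y) ⟩
  (+ 1 / y) *ᵘ (+ x / 1)
    ≈⟨ +/-≃-cross {1 * x} {y * 1} (cong₂ _*_ (*-identityˡ x) (sym (*-identityʳ y))) ⟩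
  + x / y
    ≈⟨ toℚᵘ-fromℕ-÷ᵗ-fromℕ x y ⟨
  toℚᵘ (fromℕ x ÷ᵗ fromℕ y) ∎)
  where
  open ℚᵘ.≃-Reasoning
  1÷ᵗx≡mkℚ : fromℕ 1 ÷ᵗ fromℕ x ≡ mkℚ (+ 1) x-1 (1-coprimeTo x)
  1÷ᵗx≡mkℚ = ℚ.toℚᵘ-injective (toℚᵘ-fromℕ-÷ᵗ-fromℕ 1 x)

sum-∷ʳ : ∀ {m} (c : Vec ℕ m) s → sum (c ∷ʳ s) ≡ sum c + s
sum-∷ʳ []      s = +-identityʳ s
sum-∷ʳ (x ∷ c) s = trans (cong (_+_ x) (sum-∷ʳ c s)) (sym (+-assoc x (sum c) s))

-- partialSums (x ∷ d ∷ ds) reduces to x ∷ partialSums (x + d ∷ ds), so the running total is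
-- carried in the head.
prod-partialSums-∷ʳ : ∀ {m} (c : Vec ℕ m) s →
                      prod (partialSums (c ∷ʳ s)) ≡ prod (partialSums c) * (sum c + s)
prod-partialSums-∷ʳ []       s = trans (*-identityʳ s) (sym (+-identityʳ s))
prod-partialSums-∷ʳ (x ∷ ds) s = prod-partialSums-∷-∷ʳ x ds
  where
  open ≡-Reasoning
  prod-partialSums-∷-∷ʳ : ∀ {k} x (ds : Vec ℕ k) →
    prod (partialSums ((x ∷ ds) ∷ʳ s)) ≡ prod (partialSums (x ∷ ds)) * (x + sum ds + s)
  prod-partialSums-∷-∷ʳ x []       = begin
    x * ((x + s) * 1)    ≡⟨ solve (x List.∷ s List.∷ List.[]) ⟩
    x * 1 * (x + 0 + s)  ∎
  prod-partialSums-∷-∷ʳ x (d ∷ ds) = begin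
    x * prod (partialSums ((x + d ∷ ds) ∷ʳ s))  ≡⟨ cong (x *_) (prod-partialSums-∷-∷ʳ (x + d) ds) ⟩
    x * (P * (x + d + sum ds + s))             ≡⟨ *-assoc x P _ ⟨
    x * P * (x + d + sum ds + s)               ≡⟨ cong (λ σ → x * P * (σ + s)) (+-assoc x d (sum ds)) ⟩
    x * P * (x + (d + sum ds) + s)             ∎
    where P = prod (partialSums (x + d ∷ ds))

prod-partialSums-nonZero : ∀ {m} {c : Vec ℕ m} → All (0 <_) c → NonZero (prod (partialSums c))
prod-partialSums-nonZero []                      = _
prod-partialSums-nonZero {c = _ ∷ ds} (x>0 ∷ _) = nonZero-head ds {{>-nonZero x>0}}
  where
  nonZero-head : ∀ {k x} (ds : Vec ℕ k) → .{{NonZero x}} → NonZero (prod (partialSums (x ∷ ds)))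
  nonZero-head {x = x}     []       = m*n≢0 x 1
  nonZero-head {x = suc x} (d ∷ ds) = m*n≢0 (suc x) _ {{_}} {{nonZero-head {x = suc x + d} ds}}

length≤sum : ∀ {m} {c : Vec ℕ m} → All (0 <_) c → m ≤ sum c
length≤sum []          = z≤n
length≤sum (x>0 ∷ c>0) = +-mono-≤ x>0 (length≤sum c>0)

f-denominator-nonZero : ∀ s σ .{{_ : NonZero s}} → NonZero ((σ + s) * suc (σ + s))
f-denominator-nonZero (suc _) σ = m*n≢0 (σ + _) _ {{≢-nonZero (m+1+n≢0 σ)}}

cylLength-∷ʳ-÷ᵗ-cylLength : ∀ {m} {c : Vec ℕ m} {s} → All (0 <_) c → 0 < s →
                            cylLength (c ∷ʳ s) ÷ᵗ cylLength c ≡ f s (1 + sum c)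
cylLength-∷ʳ-÷ᵗ-cylLength {c = c} {s@(suc _)} c>0 _ = begin
  cylLength (c ∷ʳ s) ÷ᵗ cylLength c
    ≡⟨ cong (λ y → (fromℕ 1 ÷ᵗ fromℕ y) ÷ᵗ cylLength c) denominator-∷ʳ ⟩
  (fromℕ 1 ÷ᵗ fromℕ (P * D)) ÷ᵗ (fromℕ 1 ÷ᵗ fromℕ (P * suc σ))
    ≡⟨ 1÷ᵗ-÷ᵗ-1÷ᵗ (P * suc σ) (P * D) ⟩
  fromℕ (P * suc σ) ÷ᵗ fromℕ (P * D)
    ≡⟨ fromℕ-÷ᵗ-fromℕ-≡ (P * suc σ) (P * D) (suc σ) D cross ⟩
  fromℕ (suc σ) ÷ᵗ fromℕ D
    ∎
  where
  open ≡-Reasoning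
  P = prod (partialSums c)
  σ = sum c
  D = (σ + s) * suc (σ + s)
  instance
    P≢0 : NonZero P
    P≢0 = prod-partialSums-nonZero c>0
    D≢0 : NonZero D
    D≢0 = f-denominator-nonZero s σ
    PD≢0 : NonZero (P * D)
    PD≢0 = m*n≢0 P D
    P[1+σ]≢0 : NonZero (P * suc σ)
    P[1+σ]≢0 = m*n≢0 P (suc σ)
  denominator-∷ʳ : prod (partialSums (c ∷ʳ s)) * suc (sum (c ∷ʳ s)) ≡ P * D
  denominator-∷ʳ = begin
    prod (partialSums (c ∷ʳ s)) * suc (sum (c ∷ʳ s))
      ≡⟨ cong₂ (λ p σ′ → p * suc σ′) (prod-partialSums-∷ʳ c s) (sum-∷ʳ c s) ⟩
    P * (σ + s) * suc (σ + s)
      ≡⟨ *-assoc P (σ + s) _ ⟩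
    P * D
      ∎
  cross : P * suc σ * D ≡ suc σ * (P * D)
  cross = trans (cong (_* D) (*-comm P (suc σ))) (*-assoc (suc σ) P D)

f≤1/[2[2s-1]] : ∀ s σ .{{_ : NonZero s}} → f s (suc σ) ≤ℚ fromℕ 1 ÷ᵗ fromℕ (2 * (2 * s ∸ 1))
f≤1/[2[2s-1]] s@(suc t) σ = fromℕ-÷ᵗ-fromℕ-≤ (suc σ) D 1 (2 * (2 * s ∸ 1)) cross
  where
  open ≤-Reasoning
  D = (σ + s) * suc (σ + s)
  instance
    D≢0 : NonZero D
    D≢0 = f-denominator-nonZero s σ
    2[2s-1]≢0 : NonZero (2 * (2 * s ∸ 1))
    2[2s-1]≢0 = m*n≢0 2 (2 * s ∸ 1) {{_}} {{≢-nonZero (m+1+n≢0 t)}}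
  cross-consecutive : ∀ σ t → suc σ * (2 * suc (2 * t)) ≤ (σ + suc t) * suc (σ + suc t)
  cross-consecutive σ t with ≤-<-connex t σ
  ... | inj₁ t≤σ with m≤n⇒∃[o]m+o≡n t≤σ
  ...   | x , refl = begin
    suc (t + x) * (2 * suc (2 * t))              ≤⟨ m≤m+n _ (x * suc x) ⟩
    suc (t + x) * (2 * suc (2 * t)) + x * suc x  ≡⟨ solve (t List.∷ x List.∷ List.[]) ⟩
    (t + x + suc t) * suc (t + x + suc t)        ∎
  cross-consecutive σ t | inj₂ σ<t with m≤n⇒∃[o]m+o≡n σ<t
  ...   | y , refl = begin
    suc σ * (2 * suc (2 * (suc σ + y)))              ≤⟨ m≤m+n _ (y * suc y) ⟩
    suc σ * (2 * suc (2 * (suc σ + y))) + y * suc y  ≡⟨ solve (σ List.∷ y List.∷ List.[]) ⟩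
    (σ + suc (suc σ + y)) * suc (σ + suc (suc σ + y))  ∎
  cross : suc σ * (2 * (2 * s ∸ 1)) ≤ 1 * D
  cross = begin
    suc σ * (2 * (2 * s ∸ 1))  ≡⟨ cong (λ k → suc σ * (2 * k)) (+-suc t (t + 0)) ⟩
    suc σ * (2 * suc (2 * t))  ≤⟨ cross-consecutive σ t ⟩
    D                          ≡⟨ *-identityˡ D ⟨
    1 * D                      ∎

f-antitone : ∀ s {μ σ} .{{_ : NonZero s}} → s ∸ 1 ≤ μ → μ ≤ σ → f s (suc σ) ≤ℚ f s (suc μ)
f-antitone s@(suc v) {μ} {σ} v≤μ μ≤σ = fromℕ-÷ᵗ-fromℕ-≤ (suc σ) Dσ (suc μ) Dμ cross
  where
  open ≤-Reasoning
  Dσ = (σ + s) * suc (σ + s)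
  Dμ = (μ + s) * suc (μ + s)
  instance
    Dσ≢0 : NonZero Dσ
    Dσ≢0 = f-denominator-nonZero s σ
    Dμ≢0 : NonZero Dμ
    Dμ≢0 = f-denominator-nonZero s μ
  cross : suc σ * Dμ ≤ suc μ * Dσ
  cross with m≤n⇒∃[o]m+o≡n v≤μ | m≤n⇒∃[o]m+o≡n μ≤σ
  ... | t , refl | e , refl = begin
    suc (v + t + e) * ((v + t + s) * suc (v + t + s))
      ≤⟨ m≤m+n _ _ ⟩
    suc (v + t + e) * ((v + t + s) * suc (v + t + s)) + e * (s + 2 * s * t + t * t + s * e + t * e)
      ≡⟨ solve (v List.∷ t List.∷ e List.∷ List.[]) ⟩
    suc (v + t) * ((v + t + e + s) * suc (v + t + e + s))
      ∎

f-suc : ∀ s μ → f s (suc μ) ≡ fromℕ (μ + 1) ÷ᵗ fromℕ ((μ + s) * (μ + s + 1))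
f-suc s μ = cong₂ (λ a d → fromℕ a ÷ᵗ fromℕ d) (+-comm 1 μ) (cong ((μ + s) *_) (+-comm 1 (μ + s)))

lemma1 : (m : ℕ) (c : Vec ℕ m) → All (1 ≤_) c → (s : ℕ) → 1 ≤ s →
    (cylLength (c ∷ʳ s) ÷ᵗ cylLength c ≡ f s (1 + sum c))
    × (f s (1 + sum c) ≤ℚ fromℕ 1 ÷ᵗ fromℕ (2 * (2 * s ∸ 1)))
    × (s ∸ 1 ≤ m →
       cylLength (c ∷ʳ s) ÷ᵗ cylLength c ≤ℚ fromℕ (m + 1) ÷ᵗ fromℕ ((m + s) * (m + s + 1)))
lemma1 m c c>0 s s>0 = ratio≡f , f≤1/[2[2s-1]] s (sum c) , ratio≤
  where
  instance
    s≢0 : NonZero s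
    s≢0 = >-nonZero s>0
  ratio≡f : cylLength (c ∷ʳ s) ÷ᵗ cylLength c ≡ f s (1 + sum c)
  ratio≡f = cylLength-∷ʳ-÷ᵗ-cylLength c>0 s>0
  ratio≤ : s ∸ 1 ≤ m →
           cylLength (c ∷ʳ s) ÷ᵗ cylLength c ≤ℚ fromℕ (m + 1) ÷ᵗ fromℕ ((m + s) * (m + s + 1))
  ratio≤ s∸1≤m = begin
    cylLength (c ∷ʳ s) ÷ᵗ cylLength c                ≡⟨ ratio≡f ⟩
    f s (suc (sum c))                                ≤⟨ f-antitone s s∸1≤m (length≤sum c>0) ⟩
    f s (suc m)                                      ≡⟨ f-suc s m ⟩
    fromℕ (m + 1) ÷ᵗ fromℕ ((m + s) * (m + s + 1))  ∎
    where open ℚ.≤-Reasoning
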